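{- For every integer $n\ge2$, \[\mathbf c_{n}=1+\sum_{k=1}^{n-1}\sum_{i=0}^{k-1}\binom{k}{i}B(n-k,k-i),\] where $\mathbf c_n$ is the $n$th Catalan number.
   Context: $\mathbf c_n=\frac{1}{n+1}\binom{2n}{n}$ is the $n$th Catalan number. For positive integers $m,j$, $B(m,j)=\frac{j}{m}\binom{2m}{m+j}$ denotes the entries of Shapiro's Catalan triangle (so $B(m,j)=0$ when $j>m$). -}

module Defs where

open import Data.Nat using (ℕ; zero; suc; _+_; _*_; _∸_; NonZero)
open import Data.Nat.DivMod using (_/_)
open import Data.Nat.Combinatorics using (_C_)

catalan : ℕ → ℕ
catalan n = ((2 * n) C n) / suc n

-- Shapiro's Catalan triangle  B(m,j) = (j/m) * binom(2m, m+j)  for m ≥ 1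
-- (exact division; binom(2m, m+j) = 0 when j > m, so B(m,j) = 0 then)
B : (m j : ℕ) → .{{NonZero m}} → ℕ
B m j = (j * ((2 * m) C (m + j))) / m

-- Σ[ i ∈ [a, b] ] f i  (inclusive range; empty, i.e. 0, when b < a)
-- defined as sum over i = a, a+1, ..., a + (count - 1)
sumFrom : ℕ → ℕ → (ℕ → ℕ) → ℕ
sumFrom a zero f = 0
sumFrom a (suc c) f = f a + sumFrom (suc a) c f

sumRange : ℕ → ℕ → (ℕ → ℕ) → ℕ
sumRange a b f = sumFrom a (suc b ∸ a) f

module Submission where

-- The proof is a chain of closed
-- forms, each a difference of two adjacent binomials:
--   (1) ballot form:  B(a+1, j) = C(2a+1, a+j) − C(2a+1, a+j+1),
--       and likewise  c_{a+1}  = C(2a+1, a+1) − C(2a+1, a+2);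
--       both follow from the ratio (k+1)·C(n,k+1) = (n−k)·C(n,k) by exact division.
--   (2) inner sum: after reflecting i ↦ k − i it is the binomial transform
--       Σ_{j=0}^{k} C(k,j) B(a+1,j), which Vandermonde's convolution applied to
--       both terms of (1) turns into C(2a+1+k, a+k) − C(2a+1+k, a+k+1).
--   (3) outer sum: along the diagonal a + k = n − 1 these differences add up, by
--       two hockey-stick identities, to C(2n−1, n) − C(2n−1, n+1) − 1.
-- Comparing (3) with the Catalan case of (1) gives the theorem.  Since ℕ has only
-- truncated subtraction, every difference x − y = d is stated as d + y ≡ x.

open import Data.Nat using (ℕ; zero; suc; _+_; _*_; _∸_; _≤_; _<_; NonZero; z≤n; s≤s; s≤s⁻¹)
open import Data.Nat.Properties
open import Data.Nat.DivMod using (_/_; m*n/n≡m)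
open import Data.Nat.Combinatorics
  using (_C_; nCk+nC[k+1]≡[n+1]C[k+1]; k>n⇒nCk≡0; nCk≡nC[n∸k]; nC1≡n; nCn≡1)
open import Data.Nat.Tactic.RingSolver using (solve-∀)
open import Relation.Binary.PropositionalEquality
  using (_≡_; refl; sym; trans; cong; cong₂; subst; module ≡-Reasoning)
open import Defs

open ≡-Reasoning

sum-shift : ∀ a c f → sumFrom (suc a) c f ≡ sumFrom a c (λ i → f (suc i))
sum-shift a zero    f = refl
sum-shift a (suc c) f = cong (f (suc a) +_) (sum-shift (suc a) c f)

sum-cong : ∀ c f g → (∀ i → i < c → f i ≡ g i) → sumFrom 0 c f ≡ sumFrom 0 c g
sum-cong zero    f g f≡g = refl
sum-cong (suc c) f g f≡g = cong₂ _+_ (f≡g 0 (s≤s z≤n)) (begin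
  sumFrom 1 c f                  ≡⟨ sum-shift 0 c f ⟩
  sumFrom 0 c (λ i → f (suc i))  ≡⟨ sum-cong c _ _ (λ i i<c → f≡g (suc i) (s≤s i<c)) ⟩
  sumFrom 0 c (λ i → g (suc i))  ≡⟨ sum-shift 0 c g ⟨
  sumFrom 1 c g                  ∎)

sum-+ : ∀ a c f g → sumFrom a c (λ i → f i + g i) ≡ sumFrom a c f + sumFrom a c g
sum-+ a zero    f g = refl
sum-+ a (suc c) f g = trans (cong (f a + g a +_) (sum-+ (suc a) c f g))
                            (interchange (f a) (g a) (sumFrom (suc a) c f) (sumFrom (suc a) c g))
  where
  interchange : ∀ x y z w → x + y + (z + w) ≡ x + z + (y + w)
  interchange = solve-∀

sum-pointwise : ∀ c f g h → (∀ i → i < c → f i + g i ≡ h i) →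
                sumFrom 0 c f + sumFrom 0 c g ≡ sumFrom 0 c h
sum-pointwise c f g h f+g≡h = trans (sym (sum-+ 0 c f g)) (sum-cong c _ h f+g≡h)

sum-last : ∀ c f → sumFrom 0 (suc c) f ≡ sumFrom 0 c f + f c
sum-last zero    f = +-comm (f 0) 0
sum-last (suc c) f = begin
  f 0 + sumFrom 1 (suc c) f                          ≡⟨ cong (f 0 +_) (sum-shift 0 (suc c) f) ⟩
  f 0 + sumFrom 0 (suc c) (λ i → f (suc i))          ≡⟨ cong (f 0 +_) (sum-last c (λ i → f (suc i))) ⟩
  f 0 + (sumFrom 0 c (λ i → f (suc i)) + f (suc c))  ≡⟨ +-assoc (f 0) _ _ ⟨
  f 0 + sumFrom 0 c (λ i → f (suc i)) + f (suc c)    ≡⟨ cong (λ s → f 0 + s + f (suc c)) (sum-shift 0 c f) ⟨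
  f 0 + sumFrom 1 c f + f (suc c)                    ∎

sum-reverse : ∀ c f → sumFrom 0 c (λ i → f (c ∸ suc i)) ≡ sumFrom 0 c f
sum-reverse zero    f = refl
sum-reverse (suc c) f = begin
  f c + sumFrom 1 c (λ i → f (suc c ∸ suc i))  ≡⟨ cong (f c +_) (sum-shift 0 c _) ⟩
  f c + sumFrom 0 c (λ i → f (c ∸ suc i))      ≡⟨ cong (f c +_) (sum-reverse c f) ⟩
  f c + sumFrom 0 c f                          ≡⟨ +-comm (f c) _ ⟩
  sumFrom 0 c f + f c                          ≡⟨ sum-last c f ⟨
  sumFrom 0 (suc c) f                          ∎

pascal : ∀ n k → suc n C suc k ≡ n C k + n C suc k
pascal n k = sym (nCk+nC[k+1]≡[n+1]C[k+1] n k)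

C-beyond : ∀ n → n C suc n ≡ 0
C-beyond n = k>n⇒nCk≡0 (n<1+n n)

absorption : ∀ n k → suc k * (suc n C suc k) ≡ suc n * (n C k)
absorption n       zero    = trans (*-identityˡ _) (trans (nC1≡n (suc n)) (sym (*-identityʳ _)))
absorption zero    (suc k) = *-zeroʳ (suc (suc k))
absorption (suc n) (suc k) = begin
  suc (suc k) * (suc (suc n) C suc (suc k))
    ≡⟨ cong (suc (suc k) *_) (pascal (suc n) (suc k)) ⟩
  suc (suc k) * (X + Y)
    ≡⟨ expand (suc k) X Y ⟩
  X + (suc k * X + suc (suc k) * Y)
    ≡⟨ cong₂ (λ u v → X + (u + v)) (absorption n k) (absorption n (suc k)) ⟩
  X + (suc n * (n C k) + suc n * (n C suc k))
    ≡⟨ cong (X +_) (*-distribˡ-+ (suc n) (n C k) (n C suc k)) ⟨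
  X + suc n * (n C k + n C suc k)
    ≡⟨ cong (λ z → X + suc n * z) (pascal n k) ⟨
  suc (suc n) * X
    ∎
  where
  X = suc n C suc k
  Y = suc n C suc (suc k)
  expand : ∀ k x y → suc k * (x + y) ≡ x + (k * x + suc k * y)
  expand = solve-∀

-- The ratio of neighbours, (k+1)·C(n,k+1) = (n−k)·C(n,k), in additive form.
ratio : ∀ n k → suc k * (n C suc k) + k * (n C k) ≡ n * (n C k)
ratio n k = +-cancelˡ-≡ (n C k) _ _ (begin
  n C k + (suc k * (n C suc k) + k * (n C k))  ≡⟨ collect k (n C k) (n C suc k) ⟩
  suc k * (n C k + n C suc k)              ≡⟨ cong (suc k *_) (pascal n k) ⟨
  suc k * (suc n C suc k)                  ≡⟨ absorption n k ⟩
  suc n * (n C k)                          ∎)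
  where
  collect : ∀ k x y → x + (suc k * y + k * x) ≡ suc k * (x + y)
  collect = solve-∀

central-symmetry : ∀ a → suc (a + a) C a ≡ suc (a + a) C suc a
central-symmetry a = trans (nCk≡nC[n∸k] (m≤n⇒m≤1+n (m≤m+n a a)))
                           (cong (suc (a + a) C_) (trans (+-∸-assoc 1 (m≤n+m a a))
                                                         (cong suc (m+n∸n≡m a a))))

double-suc : ∀ a → 2 * suc a ≡ suc (suc (a + a))
double-suc = solve-∀

quotient-of-difference : ∀ m x y w → .{{_ : NonZero m}} →
                         m * x ≡ m * y + w → w / m + y ≡ x
quotient-of-difference m x y w eq = begin
  w / m + y              ≡⟨ cong (λ v → v / m + y) w≡[x∸y]*m ⟩
  (x ∸ y) * m / m + y    ≡⟨ cong (_+ y) (m*n/n≡m (x ∸ y) m) ⟩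
  x ∸ y + y              ≡⟨ m∸n+n≡m y≤x ⟩
  x                      ∎
  where
  y≤x : y ≤ x
  y≤x = *-cancelˡ-≤ m (subst (m * y ≤_) (sym eq) (m≤m+n (m * y) w))
  w≡[x∸y]*m : w ≡ (x ∸ y) * m
  w≡[x∸y]*m = begin
    w                  ≡⟨ m+n∸m≡n (m * y) w ⟨
    m * y + w ∸ m * y  ≡⟨ cong (_∸ m * y) eq ⟨
    m * x ∸ m * y      ≡⟨ *-distribˡ-∸ m x y ⟨
    m * (x ∸ y)        ≡⟨ *-comm m (x ∸ y) ⟩
    (x ∸ y) * m        ∎

B-ballot : ∀ a j → B (suc a) j + suc (a + a) C suc (a + j) ≡ suc (a + a) C (a + j)
B-ballot a j = begin
  B (suc a) j + Y            ≡⟨ cong (λ M → (j * (M C suc (a + j))) / suc a + Y) (double-suc a) ⟩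
  (j * Z) / suc a + Y        ≡⟨ quotient-of-difference (suc a) X Y (j * Z) ballot-relation ⟩
  X                          ∎
  where
  N = suc (a + a)
  X = N C (a + j)
  Y = N C suc (a + j)
  Z = suc N C suc (a + j)
  ballot-relation : suc a * X ≡ suc a * Y + j * Z
  ballot-relation = +-cancelʳ-≡ (a * X) _ _ (begin
    suc a * X + a * X                ≡⟨ e₁ a X ⟩
    N * X                            ≡⟨ ratio N (a + j) ⟨
    suc (a + j) * Y + (a + j) * X    ≡⟨ e₂ a j X Y ⟩
    suc a * Y + j * (X + Y) + a * X  ≡⟨ cong (λ z → suc a * Y + j * z + a * X) (pascal N (a + j)) ⟨
    suc a * Y + j * Z + a * X        ∎)
    where
    e₁ : ∀ a x → suc a * x + a * x ≡ suc (a + a) * x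
    e₁ = solve-∀
    e₂ : ∀ a j x y → suc (a + j) * y + (a + j) * x ≡ suc a * y + j * (x + y) + a * x
    e₂ = solve-∀

catalan-ballot : ∀ a → catalan (suc a) + suc (a + a) C suc (suc a) ≡ suc (a + a) C suc a
catalan-ballot a = begin
  catalan (suc a) + Y                ≡⟨ cong (λ c → c / suc (suc a) + Y) central ⟩
  (X + X) / suc (suc a) + Y          ≡⟨ quotient-of-difference (suc (suc a)) X Y (X + X) catalan-relation ⟩
  X                                  ∎
  where
  N = suc (a + a)
  X = N C suc a
  Y = N C suc (suc a)
  central : (2 * suc a) C suc a ≡ X + X
  central = begin
    (2 * suc a) C suc a  ≡⟨ cong (_C suc a) (double-suc a) ⟩
    suc N C suc a        ≡⟨ pascal N a ⟩
    N C a + X            ≡⟨ cong (_+ X) (central-symmetry a) ⟩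
    X + X                ∎
  catalan-relation : suc (suc a) * X ≡ suc (suc a) * Y + (X + X)
  catalan-relation = +-cancelʳ-≡ (suc a * X) _ _ (begin
    suc (suc a) * X + suc a * X                ≡⟨ e₁ a X ⟩
    N * X + (X + X)                            ≡⟨ cong (_+ (X + X)) (ratio N (suc a)) ⟨
    suc (suc a) * Y + suc a * X + (X + X)      ≡⟨ e₂ (suc (suc a) * Y) (suc a * X) (X + X) ⟩
    suc (suc a) * Y + (X + X) + suc a * X      ∎)
    where
    e₁ : ∀ a x → suc (suc a) * x + suc a * x ≡ suc (a + a) * x + (x + x)
    e₁ = solve-∀
    e₂ : ∀ u v w → u + v + w ≡ u + w + v
    e₂ = solve-∀

-- The binomial transform  T k f = Σ_{j=0}^{k} C(k,j) f(j); the sums of the theorem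
-- are binomial transforms of columns of Shapiro's triangle.
transform : ℕ → (ℕ → ℕ) → ℕ
transform k f = sumFrom 0 (suc k) (λ j → (k C j) * f j)

transform-cong : ∀ k f g → (∀ j → f j ≡ g j) → transform k f ≡ transform k g
transform-cong k f g f≡g = sum-cong (suc k) _ _ (λ j _ → cong ((k C j) *_) (f≡g j))

transform-+ : ∀ k f g h → (∀ j → f j + g j ≡ h j) →
              transform k f + transform k g ≡ transform k h
transform-+ k f g h f+g≡h =
  sum-pointwise (suc k) (λ j → (k C j) * f j) (λ j → (k C j) * g j) (λ j → (k C j) * h j)
  (λ j _ → trans (sym (*-distribˡ-+ (k C j) (f j) (g j))) (cong ((k C j) *_) (f+g≡h j)))

transform-head : ∀ k f → transform k f ≡ f 0 + sumFrom 0 k (λ j → (k C suc j) * f (suc j))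
transform-head k f = cong₂ _+_ (*-identityˡ (f 0)) (sum-shift 0 k _)

transform-step : ∀ k f → transform (suc k) f ≡ transform k (λ j → f j + f (suc j))
transform-step k f = begin
  transform (suc k) f
    ≡⟨ transform-head (suc k) f ⟩
  f 0 + sumFrom 0 (suc k) (λ j → (suc k C suc j) * f (suc j))
    ≡⟨ cong (f 0 +_) (sum-pointwise (suc k) (λ j → (k C j) * f (suc j)) (λ j → (k C suc j) * f (suc j))
                                      (λ j → (suc k C suc j) * f (suc j)) (λ j _ → pascal-term j)) ⟨
  f 0 + (transform k (λ j → f (suc j)) + sumFrom 0 (suc k) (λ j → (k C suc j) * f (suc j)))
    ≡⟨ cong (λ s → f 0 + (transform k (λ j → f (suc j)) + s)) drop-last ⟩
  f 0 + (transform k (λ j → f (suc j)) + S)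
    ≡⟨ rearrange (f 0) _ S ⟩
  (f 0 + S) + transform k (λ j → f (suc j))
    ≡⟨ cong (_+ transform k (λ j → f (suc j))) (transform-head k f) ⟨
  transform k f + transform k (λ j → f (suc j))
    ≡⟨ transform-+ k f (λ j → f (suc j)) (λ j → f j + f (suc j)) (λ j → refl) ⟩
  transform k (λ j → f j + f (suc j))
    ∎
  where
  S = sumFrom 0 k (λ j → (k C suc j) * f (suc j))
  pascal-term : ∀ j → (k C j) * f (suc j) + (k C suc j) * f (suc j) ≡ (suc k C suc j) * f (suc j)
  pascal-term j = trans (sym (*-distribʳ-+ (f (suc j)) (k C j) _))
                        (cong (_* f (suc j)) (sym (pascal k j)))
  drop-last : sumFrom 0 (suc k) (λ j → (k C suc j) * f (suc j)) ≡ S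
  drop-last = trans (sum-last k _) (trans (cong (λ c → S + c * f (suc k)) (C-beyond k)) (+-identityʳ S))
  rearrange : ∀ x y z → x + (y + z) ≡ x + z + y
  rearrange = solve-∀

vandermonde : ∀ k N s → transform k (λ j → N C (s + j)) ≡ (N + k) C (s + k)
vandermonde zero    N s = trans (+-identityʳ _)
                           (trans (*-identityˡ _) (cong (_C (s + 0)) (sym (+-identityʳ N))))
vandermonde (suc k) N s = begin
  transform (suc k) (λ j → N C (s + j))
    ≡⟨ transform-step k (λ j → N C (s + j)) ⟩
  transform k (λ j → N C (s + j) + N C (s + suc j))
    ≡⟨ transform-cong k _ _ merge ⟩
  transform k (λ j → suc N C (suc s + j))
    ≡⟨ vandermonde k (suc N) (suc s) ⟩
  (suc N + k) C (suc s + k)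
    ≡⟨ cong₂ _C_ (sym (+-suc N k)) (sym (+-suc s k)) ⟩
  (N + suc k) C (s + suc k)
    ∎
  where
  merge : ∀ j → N C (s + j) + N C (s + suc j) ≡ suc N C (suc s + j)
  merge j = trans (cong (λ i → N C (s + j) + N C i) (+-suc s j)) (sym (pascal N (s + j)))

-- Reflecting the summation index (C(k,i) = C(k,k−i)); the extra term j = 0
-- of the transform vanishes when f 0 = 0.
transform-reflect : ∀ k f → f 0 ≡ 0 → sumFrom 0 k (λ i → (k C i) * f (k ∸ i)) ≡ transform k f
transform-reflect k f f0≡0 = begin
  sumFrom 0 k (λ i → (k C i) * f (k ∸ i))
    ≡⟨ +-identityʳ _ ⟨
  sumFrom 0 k (λ i → (k C i) * f (k ∸ i)) + 0
    ≡⟨ cong (sumFrom 0 k (λ i → (k C i) * f (k ∸ i)) +_) last-term ⟨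
  sumFrom 0 k (λ i → (k C i) * f (k ∸ i)) + (k C k) * f (k ∸ k)
    ≡⟨ sum-last k _ ⟨
  sumFrom 0 (suc k) (λ i → (k C i) * f (k ∸ i))
    ≡⟨ sum-cong (suc k) _ _ (λ i i≤k → cong (_* f (k ∸ i)) (nCk≡nC[n∸k] (s≤s⁻¹ i≤k))) ⟩
  sumFrom 0 (suc k) (λ i → (k C (k ∸ i)) * f (k ∸ i))
    ≡⟨ sum-reverse (suc k) (λ j → (k C j) * f j) ⟩
  transform k f
    ∎
  where
  last-term : (k C k) * f (k ∸ k) ≡ 0
  last-term = trans (cong ((k C k) *_) (trans (cong f (n∸n≡0 k)) f0≡0)) (*-zeroʳ (k C k))

hockey-stick : ∀ q c → sumFrom 0 c (λ u → (q + u) C q) ≡ (q + c) C suc q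
hockey-stick q zero    = sym (trans (cong (_C suc q) (+-identityʳ q)) (C-beyond q))
hockey-stick q (suc c) = begin
  sumFrom 0 (suc c) (λ u → (q + u) C q)     ≡⟨ sum-last c _ ⟩
  sumFrom 0 c (λ u → (q + u) C q) + (q + c) C q
                                            ≡⟨ cong (_+ (q + c) C q) (hockey-stick q c) ⟩
  (q + c) C suc q + (q + c) C q             ≡⟨ +-comm _ ((q + c) C q) ⟩
  (q + c) C q + (q + c) C suc q             ≡⟨ pascal (q + c) q ⟨
  suc (q + c) C suc q                       ≡⟨ cong (_C suc q) (+-suc q c) ⟨
  (q + suc c) C suc q                       ∎

inner-sum : ∀ a k r → a + k ≡ r →
            transform k (λ j → B (suc a) j) + (suc r + a) C suc r ≡ (suc r + a) C r
inner-sum a k .(a + k) refl = begin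
  T + (suc (a + k) + a) C suc (a + k)         ≡⟨ cong (λ M → T + M C suc (a + k)) row ⟨
  T + (N + k) C (suc a + k)                   ≡⟨ cong (T +_) (vandermonde k N (suc a)) ⟨
  T + transform k (λ j → N C (suc a + j))     ≡⟨ transform-+ k (λ j → B (suc a) j) (λ j → N C (suc a + j))
                                                                  (λ j → N C (a + j)) (B-ballot a) ⟩
  transform k (λ j → N C (a + j))             ≡⟨ vandermonde k N a ⟩
  (N + k) C (a + k)                           ≡⟨ cong (_C (a + k)) row ⟩
  (suc (a + k) + a) C (a + k)                 ∎
  where
  N = suc (a + a)
  T = transform k (λ j → B (suc a) j)
  row : suc (a + a) + k ≡ suc (a + k) + a
  row = cong suc (trans (+-assoc a a k) (trans (cong (a +_) (+-comm a k)) (sym (+-assoc a k a))))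

outer-sum : ∀ r c I → (∀ a → a < c → I a + (suc r + a) C suc r ≡ (suc r + a) C r) →
            1 + sumFrom 0 c I + (suc r + c) C suc (suc r) ≡ (suc r + c) C suc r
outer-sum r c I ballot = begin
  1 + sumFrom 0 c I + (suc r + c) C suc (suc r)
    ≡⟨ cong (1 + sumFrom 0 c I +_) (hockey-stick (suc r) c) ⟨
  1 + sumFrom 0 c I + sumFrom 0 c (λ a → (suc r + a) C suc r)
    ≡⟨ +-assoc 1 (sumFrom 0 c I) _ ⟩
  1 + (sumFrom 0 c I + sumFrom 0 c (λ a → (suc r + a) C suc r))
    ≡⟨ cong (1 +_) (sum-pointwise c _ _ _ ballot) ⟩
  1 + sumFrom 0 c (λ a → (suc r + a) C r)
    ≡⟨ cong₂ _+_ (trans (sym (nCn≡1 r)) (cong (_C r) (sym (+-identityʳ r))))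
                 (sum-cong c _ _ (λ a _ → cong (_C r) (sym (+-suc r a)))) ⟩
  (r + 0) C r + sumFrom 0 c (λ a → (r + suc a) C r)
    ≡⟨ cong ((r + 0) C r +_) (sum-shift 0 c (λ u → (r + u) C r)) ⟨
  sumFrom 0 (suc c) (λ u → (r + u) C r)
    ≡⟨ hockey-stick r (suc c) ⟩
  (r + suc c) C suc r
    ≡⟨ cong (_C suc r) (+-suc r c) ⟩
  (suc r + c) C suc r
    ∎

-- For n = p + 2 both c_n and 1 + (the double sum) equal C(2n−1, n) − C(2n−1, n+1).
corollary6 : (n : ℕ) → 2 ≤ n →
    catalan n ≡ 1 + sumRange 1 (n ∸ 1) (λ k → sumRange 0 (k ∸ 1) (λ i → (k C i) * B (suc (n ∸ 1 ∸ k)) (k ∸ i)))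
corollary6 (suc zero) (s≤s ())
corollary6 (suc (suc p)) _ = +-cancelʳ-≡ _ _ _ (begin
  catalan (suc (suc p)) + M C suc (suc (suc p))         ≡⟨ catalan-ballot (suc p) ⟩
  M C suc (suc p)                                       ≡⟨ outer-sum (suc p) (suc p) I diagonal ⟨
  1 + sumFrom 0 (suc p) I + M C suc (suc (suc p))       ≡⟨ cong (λ s → 1 + s + M C suc (suc (suc p))) columns ⟨
  1 + sumFrom 1 (suc p) F + M C suc (suc (suc p))       ∎)
  where
  M = suc (suc p + suc p)
  F = λ k → sumRange 0 (k ∸ 1) (λ i → (k C i) * B (suc (suc p ∸ k)) (k ∸ i))
  -- the column with B(a+1, ·), a = 0 … p, sits at k = p + 1 − a
  I = λ a → transform (suc (p ∸ a)) (λ j → B (suc a) j)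
  diagonal : ∀ a → a < suc p → I a + (suc (suc p) + a) C suc (suc p) ≡ (suc (suc p) + a) C suc p
  diagonal a a<1+p = inner-sum a (suc (p ∸ a)) (suc p)
                       (trans (+-suc a _) (cong suc (m+[n∸m]≡n (s≤s⁻¹ a<1+p))))
  columns : sumFrom 1 (suc p) F ≡ sumFrom 0 (suc p) I
  columns = begin
    sumFrom 1 (suc p) F                             ≡⟨ sum-shift 0 (suc p) F ⟩
    sumFrom 0 (suc p) (λ t → F (suc t))             ≡⟨ sum-reverse (suc p) (λ t → F (suc t)) ⟨
    sumFrom 0 (suc p) (λ a → F (suc (p ∸ a)))       ≡⟨ sum-cong (suc p) _ _ column ⟩
    sumFrom 0 (suc p) I                             ∎
    where
    column : ∀ a → a < suc p → F (suc (p ∸ a)) ≡ I a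
    column a a<1+p = trans
      (cong (λ x → sumFrom 0 k (λ i → (k C i) * B (suc x) (k ∸ i))) (m∸[m∸n]≡n (s≤s⁻¹ a<1+p)))
      (transform-reflect k (λ j → B (suc a) j) refl)
      where k = suc (p ∸ a)
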